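{- Let $\mathcal{S}$ be an expressivity situation and $x\colon X\to BX$ a $B$-coalgebra. If the set $\{[\![\varphi]\!]_x\mid\varphi\in L_{\mathcal{S}}\}\subseteq\mathcal{C}(X,\Omega)$ is approximating, then $\mathcal{S}$ is expressive for $x$, i.e. $\nu\bigl(x^*\circ\overline{B}^{\underline{\Omega},\tau}\bigr)\sqsupseteq\bigwedge_{\varphi\in L_{\mathcal{S}}}[\![\varphi]\!]_x^*\underline{\Omega}$.
   Context: A $\mathbf{CLat}_\sqcap$-fibration is a fibration $p\colon\mathcal{E}\to\mathcal{C}$ whose fibers are complete lattices (order $\sqsubseteq$, meets $\bigwedge$) with meet-preserving reindexing $f^*$. An expressivity situation $\mathcal{S}$ consists of such $p$; a functor $B\colon\mathcal{C}\to\mathcal{C}$; $\Omega\in\mathcal{C}$ with finite powers and $\underline{\Omega}\in\mathcal{E}$ above $\Omega$; a ranked alphabet $\Sigma$ with arrows $f_\sigma\colon\Omega^{\mathrm{rank}(\sigma)}\to\Omega$ each lifting to $g_\sigma\colon\underline{\Omega}^{\mathrm{rank}(\sigma)}\to\underline{\Omega}$ ($pg_\sigma=f_\sigma$); a set $\Lambda$ and arrows $\tau_\lambda\colon B\Omega\to\Omega$. Formulas of $L_{\mathcal{S}}$: $\varphi::=\sigma(\varphi_1,\dots,\varphi_{\mathrm{rank}(\sigma)})\mid\heartsuit_\lambda\varphi$, with semantics $[\![\sigma(\varphi_1,\dots,\varphi_n)]\!]_x=f_\sigma\circ\langle[\![\varphi_i]\!]_x\rangle_i$, $[\![\heartsuit_\lambda\varphi]\!]_x=\tau_\lambda\circ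 B[\![\varphi]\!]_x\circ x$. Codensity lifting: $\overline{B}^{\underline{\Omega},\tau}P=\bigwedge_{\lambda\in\Lambda,\,h\in\mathcal{E}(P,\underline{\Omega})}(\tau_\lambda\circ B(ph))^*\underline{\Omega}$; codensity bisimilarity $\nu(x^*\circ\overline{B}^{\underline{\Omega},\tau})$ is its greatest fixed point on $\mathcal{E}_X$. $\mathcal{S}$ is expressive for $x$ if codensity bisimilarity $\sqsupseteq$ logical equivalence $\bigwedge_{\varphi}[\![\varphi]\!]_x^*\underline{\Omega}$. A subset $S\subseteq\mathcal{C}(X,\Omega)$ is approximating if for every $\mathcal{E}$-arrow $h\colon\bigwedge_{k\in S}k^*\underline{\Omega}\to\underline{\Omega}$ and every $\lambda\in\Lambda$, $\bigwedge_{k'\in S,\lambda'\in\Lambda}(\tau_{\lambda'}\circ Bk')^*\underline{\Omega}\sqsubseteq(\tau_\lambda\circ B(ph))^*\underline{\Omega}$. -}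

module Defs where

open import Level using (Level; suc; _⊔_; Lift; lift; lower)
open import Data.Nat using (ℕ)
open import Data.Fin using (Fin)
open import Data.Product using (Σ; _×_; _,_)
open import Relation.Binary using (IsEquivalence)

record Category (ℓ : Level) : Set (suc ℓ) where
  infix  4 _≈_
  infixr 9 _∘_
  field
    Obj    : Set ℓ
    Hom    : Obj → Obj → Set ℓ
    _≈_    : ∀ {A B} → Hom A B → Hom A B → Set ℓ
    ≈-equiv : ∀ {A B} → IsEquivalence (_≈_ {A} {B})
    id     : ∀ {A} → Hom A A
    _∘_    : ∀ {A B C} → Hom B C → Hom A B → Hom A C
    assoc  : ∀ {A B C D} {f : Hom A B} {g : Hom B C} {h : Hom C D} →
             (h ∘ g) ∘ f ≈ h ∘ (g ∘ f)
    identityˡ : ∀ {A B} {f : Hom A B} → id ∘ f ≈ f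
    identityʳ : ∀ {A B} {f : Hom A B} → f ∘ id ≈ f
    ∘-resp-≈  : ∀ {A B C} {f h : Hom B C} {g i : Hom A B} →
                f ≈ h → g ≈ i → f ∘ g ≈ h ∘ i

record Endofunctor {ℓ : Level} (C : Category ℓ) : Set ℓ where
  open Category C
  field
    F₀ : Obj → Obj
    F₁ : ∀ {A B} → Hom A B → Hom (F₀ A) (F₀ B)
    F-resp-≈ : ∀ {A B} {f g : Hom A B} → f ≈ g → F₁ f ≈ F₁ g
    F-id : ∀ {A} → F₁ (id {A}) ≈ id
    F-∘  : ∀ {A B C} {f : Hom A B} {g : Hom B C} → F₁ (g ∘ f) ≈ F₁ g ∘ F₁ f

record FinitePowers {ℓ : Level} (C : Category ℓ) (Ω : Category.Obj C) : Set ℓ where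
  open Category C
  field
    pow   : ℕ → Obj
    π     : ∀ {n} → Fin n → Hom (pow n) Ω
    tuple : ∀ {X n} → (Fin n → Hom X Ω) → Hom X (pow n)
    π-tuple : ∀ {X n} (fs : Fin n → Hom X Ω) (i : Fin n) → π i ∘ tuple fs ≈ fs i
    tuple-unique : ∀ {X n} (fs : Fin n → Hom X Ω) (g : Hom X (pow n)) →
                   (∀ i → π i ∘ g ≈ fs i) → g ≈ tuple fs

-- CLat_⊓-fibrations, presented (equivalently, via the Grothendieck
-- construction) as indexed complete lattices with meet-preserving
-- reindexing.  An E-arrow P → Q above f : X → Y is exactly a proof of
-- P ⊑ f* Q.

record CLatFibration {ℓ : Level} (C : Category ℓ) : Set (suc ℓ) where
  open Category C
  infix 4 _⊑_
  field
    Fib  : Obj → Set ℓ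
    _⊑_  : ∀ {X} → Fib X → Fib X → Set ℓ
    ⊑-refl  : ∀ {X} {P : Fib X} → P ⊑ P
    ⊑-trans : ∀ {X} {P Q R : Fib X} → P ⊑ Q → Q ⊑ R → P ⊑ R
    ⋀     : ∀ {X} (I : Set ℓ) → (I → Fib X) → Fib X
    ⋀-lb  : ∀ {X} {I : Set ℓ} (P : I → Fib X) (i : I) → ⋀ I P ⊑ P i
    ⋀-glb : ∀ {X} {I : Set ℓ} (P : I → Fib X) {Q : Fib X} →
            (∀ i → Q ⊑ P i) → Q ⊑ ⋀ I P
    _*   : ∀ {X Y} → Hom X Y → Fib Y → Fib X
    *-mono : ∀ {X Y} (f : Hom X Y) {P Q : Fib Y} → P ⊑ Q → (f *) P ⊑ (f *) Q
    *-⋀    : ∀ {X Y} (f : Hom X Y) (I : Set ℓ) (P : I → Fib Y) →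
             ⋀ I (λ i → (f *) (P i)) ⊑ (f *) (⋀ I P)
    *-resp-≈ : ∀ {X Y} {f g : Hom X Y} → f ≈ g → ∀ P → (f *) P ⊑ (g *) P
    id*ˡ : ∀ {X} (P : Fib X) → (id *) P ⊑ P
    id*ʳ : ∀ {X} (P : Fib X) → P ⊑ (id *) P
    ∘*ˡ  : ∀ {X Y Z} (f : Hom X Y) (g : Hom Y Z) (P : Fib Z) →
           ((g ∘ f) *) P ⊑ (f *) ((g *) P)
    ∘*ʳ  : ∀ {X Y Z} (f : Hom X Y) (g : Hom Y Z) (P : Fib Z) →
           (f *) ((g *) P) ⊑ ((g ∘ f) *) P

record ExpressivitySituation (ℓ : Level) : Set (suc ℓ) where
  field
    C   : Category ℓ
    p   : CLatFibration C
    B   : Endofunctor C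
  open Category C
  open CLatFibration p
  open Endofunctor B
  field
    Ω      : Obj
    powers : FinitePowers C Ω
    Ω̲      : Fib Ω
  open FinitePowers powers
  -- Ω̲^n, the n-th power of Ω̲ in E (lying above Ω^n)
  Ω̲^ : (n : ℕ) → Fib (pow n)
  Ω̲^ n = ⋀ (Lift ℓ (Fin n)) (λ i → (π (lower i) *) Ω̲)
  field
    Sym  : Set ℓ
    rank : Sym → ℕ
    f    : (σ : Sym) → Hom (pow (rank σ)) Ω
    g    : (σ : Sym) → Ω̲^ (rank σ) ⊑ (f σ *) Ω̲
    Λ    : Set ℓ
    τ    : Λ → Hom (F₀ Ω) Ω

module _ {ℓ : Level} (S : ExpressivitySituation ℓ) where
  open ExpressivitySituation S
  open Category C
  open CLatFibration p
  open Endofunctor B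
  open FinitePowers powers

  data Formula : Set ℓ where
    op    : (σ : Sym) → (Fin (rank σ) → Formula) → Formula
    heart : Λ → Formula → Formula

  ⟦_⟧ : ∀ {X} → Formula → Hom X (F₀ X) → Hom X Ω
  ⟦ op σ φs ⟧ x = f σ ∘ tuple (λ i → ⟦ φs i ⟧ x)
  ⟦ heart λ′ φ ⟧ x = τ λ′ ∘ (F₁ (⟦ φ ⟧ x) ∘ x)

  -- E-arrows h : P → Ω̲ (with p h = k)
  EArrowΩ : ∀ {X} → Fib X → Set ℓ
  EArrowΩ {X} P = Σ (Hom X Ω) (λ k → P ⊑ (k *) Ω̲)

  codensityLifting : ∀ {X} → Fib X → Fib (F₀ X)
  codensityLifting P =
    ⋀ (Λ × EArrowΩ P) (λ { (λ′ , (k , _)) → ((τ λ′ ∘ F₁ k) *) Ω̲ })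

  -- greatest fixed point (Knaster–Tarski): join of all post-fixed points,
  -- the join being the meet of all upper bounds of post-fixed points
  gfp : ∀ {X} → (Fib X → Fib X) → Fib X
  gfp {X} F = ⋀ (Σ (Fib X) (λ Q → ∀ P → P ⊑ F P → P ⊑ Q)) (λ { (Q , _) → Q })

  codensityBisim : ∀ {X} → Hom X (F₀ X) → Fib X
  codensityBisim x = gfp (λ P → (x *) (codensityLifting P))

  logEquiv : ∀ {X} → Hom X (F₀ X) → Fib X
  logEquiv x = ⋀ Formula (λ φ → ((⟦ φ ⟧ x) *) Ω̲)

  Expressive : ∀ {X} → Hom X (F₀ X) → Set ℓ
  Expressive x = logEquiv x ⊑ codensityBisim x

  Approximating : ∀ {X} → (Hom X Ω → Set ℓ) → Set ℓ
  Approximating {X} Sub =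
    (h : EArrowΩ (⋀ (Σ (Hom X Ω) Sub) (λ { (k , _) → (k *) Ω̲ }))) →
    (λ′ : Λ) →
    ⋀ ((Σ (Hom X Ω) Sub) × Λ) (λ { ((k′ , _) , λ″) → ((τ λ″ ∘ F₁ k′) *) Ω̲ })
      ⊑ ((τ λ′ ∘ F₁ (Data.Product.proj₁ h)) *) Ω̲

  semanticsSet : ∀ {X} → Hom X (F₀ X) → Hom X Ω → Set ℓ
  semanticsSet x k = Σ Formula (λ φ → ⟦ φ ⟧ x ≈ k)

{-# OPTIONS --safe #-}
-- Logical equivalence is a post-fixed point of x* ∘ B̄, hence below codensity
-- bisimilarity by coinduction. For a test h : L → Ω̲ out of logical equivalence
-- L, approximation bounds the lifting test (τ_λ ∘ B(p h))* Ω̲ below the meet of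
-- the tests (τ_λ′ ∘ B[[φ]]_x)* Ω̲, and each of these, reindexed along x, is the
-- semantics of the formula ♡_λ′ φ, so it lies above L.
module Submission where

open import Level using (Level)
open import Data.Product using (Σ; _×_; _,_; proj₁)
open import Relation.Binary using (IsEquivalence)
open import Defs

module CLatFibrationProperties {ℓ : Level} {C : Category ℓ} (p : CLatFibration C) where
  open Category C
  open CLatFibration p

  ⋀-antitone : ∀ {X} {I J : Set ℓ} {P : J → Fib X} {Q : I → Fib X} (r : I → J) →
               (∀ i → P (r i) ⊑ Q i) → ⋀ J P ⊑ ⋀ I Q
  ⋀-antitone r P⊑Q = ⋀-glb _ (λ i → ⊑-trans (⋀-lb _ (r i)) (P⊑Q i))

  ⊑-*⋀ : ∀ {X Y} {I : Set ℓ} (f : Hom X Y) {P : Fib X} {Q : I → Fib Y} →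
         (∀ i → P ⊑ (f *) (Q i)) → P ⊑ (f *) (⋀ I Q)
  ⊑-*⋀ f P⊑fQ = ⊑-trans (⋀-glb _ P⊑fQ) (*-⋀ f _ _)

module ExpressivityProperties {ℓ : Level} (S : ExpressivitySituation ℓ) where
  open ExpressivitySituation S
  open Category C
  open CLatFibration p
  open Endofunctor B
  open CLatFibrationProperties p

  ≈-refl : ∀ {A B} {f : Hom A B} → f ≈ f
  ≈-refl = IsEquivalence.refl ≈-equiv

  ≈-sym : ∀ {A B} {f g : Hom A B} → f ≈ g → g ≈ f
  ≈-sym = IsEquivalence.sym ≈-equiv

  postfixed⊑gfp : ∀ {X} (F : Fib X → Fib X) {P : Fib X} → P ⊑ F P → P ⊑ gfp S F
  postfixed⊑gfp F P⊑FP = ⋀-glb _ (λ { (_ , ub) → ub _ P⊑FP })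

  module _ {X : Obj} (x : Hom X (F₀ X)) where

    semanticMeet : (Hom X Ω → Set ℓ) → Fib X
    semanticMeet Sub = ⋀ (Σ (Hom X Ω) Sub) (λ k → (proj₁ k *) Ω̲)

    modalMeet : (Hom X Ω → Set ℓ) → Fib (F₀ X)
    modalMeet Sub = ⋀ (Σ (Hom X Ω) Sub × Λ) (λ { (k , λ′) → ((τ λ′ ∘ F₁ (proj₁ k)) *) Ω̲ })

    semanticMeet⊑logEquiv : semanticMeet (semanticsSet S x) ⊑ logEquiv S x
    semanticMeet⊑logEquiv = ⋀-antitone (λ φ → ⟦_⟧ S φ x , φ , ≈-refl) (λ _ → ⊑-refl)

    logEquiv⊑heart : ∀ λ′ φ → logEquiv S x ⊑ (x *) (((τ λ′ ∘ F₁ (⟦_⟧ S φ x)) *) Ω̲)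
    logEquiv⊑heart λ′ φ =
      ⊑-trans (⋀-lb _ (heart λ′ φ))
        (⊑-trans (*-resp-≈ (≈-sym assoc) Ω̲) (∘*ˡ x (τ λ′ ∘ F₁ (⟦_⟧ S φ x)) Ω̲))

    logEquiv⊑modalMeet : logEquiv S x ⊑ (x *) (modalMeet (semanticsSet S x))
    logEquiv⊑modalMeet = ⊑-*⋀ x λ { ((k , φ , ⟦φ⟧≈k) , λ′) →
      ⊑-trans (logEquiv⊑heart λ′ φ)
        (*-mono x (*-resp-≈ (∘-resp-≈ ≈-refl (F-resp-≈ ⟦φ⟧≈k)) Ω̲)) }

    logEquiv-postfixed : Approximating S (semanticsSet S x) →
                         logEquiv S x ⊑ (x *) (codensityLifting S (logEquiv S x))
    logEquiv-postfixed approx = ⊑-*⋀ x λ { (λ′ , k , h) →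
      ⊑-trans logEquiv⊑modalMeet
        (*-mono x (approx (k , ⊑-trans semanticMeet⊑logEquiv h) λ′)) }

open ExpressivityProperties

mainTheorem2 : ∀ {ℓ : Level} (S : ExpressivitySituation ℓ) →
    let open ExpressivitySituation S in
    ∀ {X : Category.Obj C} (x : Category.Hom C X (Endofunctor.F₀ B X)) →
    Approximating S (semanticsSet S x) →
    Expressive S x
mainTheorem2 S x approx = postfixed⊑gfp S _ (logEquiv-postfixed S x approx)
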